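{- Let $n\ge2$ and let $A(n)$ be the adjacency matrix of the underlying graph of the Farey map $\mathcal{M}_3(n)$. Let $v_i=[a/c]_n$ and $v_j=[b/d]_n$ be vertices (possibly equal) with $ad-bc\equiv0\pmod n$. Then the $(i,j)$ entry of $A(n)^2-nI$ is $0$.
   Context: For $n\ge2$ the underlying graph of the Farey map $\mathcal{M}_3(n)$ has vertices the pairs $(a,c)\in(\mathbb{Z}/n\mathbb{Z})^2$ with $\gcd(a,c,n)=1$ modulo $(a,c)\sim(-a,-c)$, written $[a/c]_n$, with $[a/c]_n$ and $[b/d]_n$ adjacent iff $ad-bc\equiv\pm1\pmod n$. (The condition $ad-bc\equiv0\pmod n$ does not depend on the chosen representatives.) The rows and columns of $A(n)$ are indexed by the vertices $v_1,v_2,\dots$. -}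

module Defs where

open import Data.Nat using (ℕ; zero; suc; _+_; _*_; _∸_; _<ᵇ_; _≡ᵇ_; NonZero)
open import Data.Nat.DivMod using (_%_)
open import Data.Nat.GCD using (gcd)
open import Data.Integer as ℤ using (ℤ; +_)
open import Data.Integer.DivMod using (_%ℕ_)
open import Data.Bool using (Bool; true; false; _∧_; _∨_; if_then_else_)
open import Data.Product using (_×_; _,_)
open import Data.List using (List; filterᵇ; cartesianProduct; upTo; length; lookup; foldr; map)
open import Data.List.Base using (allFin)
open import Data.Fin using (Fin; _≟_)
open import Relation.Nullary using (does)

-- Residues mod n are represented by their canonical representatives 0 ≤ a < n.
-- A vertex [a/c]_n is the class {(a,c), (-a,-c)}; we represent it by the
-- lexicographically smaller of its two representatives.

module _ (n : ℕ) .{{_ : NonZero n}} where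

  negMod : ℕ → ℕ
  negMod a = (n ∸ a) % n

  canonical : ℕ × ℕ → Bool
  canonical (a , c) = (a <ᵇ negMod a) ∨ ((a ≡ᵇ negMod a) ∧ ((c <ᵇ negMod c) ∨ (c ≡ᵇ negMod c)))

  primitive? : ℕ × ℕ → Bool
  primitive? (a , c) = gcd (gcd a c) n ≡ᵇ 1

  vertices : List (ℕ × ℕ)
  vertices = filterᵇ (λ p → primitive? p ∧ canonical p) (cartesianProduct (upTo n) (upTo n))

  N : ℕ
  N = length vertices

  vtx : Fin N → ℕ × ℕ
  vtx = lookup vertices

  detMod : ℕ × ℕ → ℕ × ℕ → ℕ
  detMod (a , c) (b , d) = (+ (a * d) ℤ.- + (b * c)) %ℕ n

  adjacent : ℕ × ℕ → ℕ × ℕ → Bool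
  adjacent v w = (detMod v w ≡ᵇ 1) ∨ (detMod v w ≡ᵇ (n ∸ 1))

  A : Fin N → Fin N → ℤ
  A i j = if adjacent (vtx i) (vtx j) then + 1 else + 0

  sumℤ : List ℤ → ℤ
  sumℤ = foldr ℤ._+_ (+ 0)

  A² : Fin N → Fin N → ℤ
  A² i j = sumℤ (map (λ k → A i k ℤ.* A k j) (allFin N))

  I : Fin N → Fin N → ℤ
  I i j = if does (i ≟ j) then + 1 else + 0

  A²-nI : Fin N → Fin N → ℤ
  A²-nI i j = A² i j ℤ.- (+ n) ℤ.* I i j

module Submission where

-- Since v is primitive, Bézout
-- gives u₀ with det(v, u₀) ≡ 1, and the neighbours of [v] are exactly the n classes
-- [t v + u₀], t ∈ ℤ/n: they are distinct because t ≡ det(t v + u₀, u₀), and every w with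
-- det(v, w) ≡ 1 is ≡ det(w, u₀) v + u₀ by Cramer's rule  det(v, u) w = det(w, u) v + det(v, w) u.
-- So the diagonal entries of A(n)² are n.  If det(v, w) ≡ 0 and u is a common neighbour, the
-- same rule gives ±w ≡ ±v, i.e. [v] = [w]; hence two distinct vertices with det ≡ 0 have no
-- common neighbour, and the corresponding entry of A(n)² vanishes.

open import Defs
open import Data.Bool using (Bool; true; false; T; _∧_; _∨_; if_then_else_)
open import Data.Bool.Properties using (T-∧; T-∨)
open import Data.Empty using (⊥; ⊥-elim)
open import Data.Fin using (Fin; zero; suc; _≟_)
open import Data.Integer as ℤ using (ℤ; +_; -[1+_]; _+_; _*_; -_; _-_; _◃_)
open import Data.Integer.DivMod using (_%ℕ_; _/ℕ_; a≡a%ℕn+[a/ℕn]*n; n%ℕd<d)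
open import Data.Integer.Divisibility.Signed using (_∣_; ∣ᵤ⇒∣; ∣⇒∣ᵤ; ∣m∣n⇒∣m-n; ∣n⇒∣m*n; ∣m⇒∣m*n; ∣m+n∣n⇒∣m)
import Data.Integer.Properties as ℤ
open import Data.Integer.Tactic.RingSolver using (solve-∀)
open import Data.List using (List; []; _∷_; length; map; foldr; lookup; tabulate; filterᵇ; cartesianProduct; upTo; applyUpTo)
open import Data.List.Base using (allFin)
open import Data.List.Membership.Propositional using (_∈_)
open import Data.List.Membership.Propositional.Properties
  using (∈-lookup; ∈-filter⁺; ∈-filter⁻; ∈-applyUpTo⁺; ∈-applyUpTo⁻; ∈-cartesianProduct⁺; ∈-cartesianProduct⁻; ∈-upTo⁺; ∈-upTo⁻)
open import Data.List.Membership.Propositional.Properties.WithK using (unique∧set⇒bag)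
open import Data.List.Properties using (length-applyUpTo; map-cong; map-tabulate; tabulate-lookup)
open import Data.List.Relation.Binary.BagAndSetEquality using (_∼[_]_; set; ∼bag⇒↭)
open import Data.List.Relation.Binary.Permutation.Propositional.Properties using (↭-length)
import Data.List.Relation.Unary.All as All
open import Data.List.Relation.Unary.AllPairs using (_∷_)
open import Data.List.Relation.Unary.Unique.Propositional using (Unique)
open import Data.List.Relation.Unary.Unique.Propositional.Properties using (filter⁺; cartesianProduct⁺; upTo⁺; applyUpTo⁺₁)
open import Data.Nat as ℕ using (ℕ; zero; suc; NonZero; _≤_; _<_)
open import Data.Nat.Divisibility using (∣-trans; ∣1⇒≡1) renaming (_∣_ to _∣ℕ_)
open import Data.Nat.GCD using (gcd; gcd-GCD; gcd[m,n]∣m; gcd[m,n]∣n; module Bézout)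
import Data.Nat.Properties as ℕ
open import Data.Product using (∃-syntax; _×_; _,_; proj₁; proj₂)
open import Data.Product.Function.NonDependent.Propositional using (_×-cong_)
open import Data.Product.Relation.Binary.Lex.NonStrict using (×-decTotalOrder)
open import Data.Product.Relation.Binary.Pointwise.NonDependent using (Pointwise; ×-setoid; ≡×≡⇒≡)
open import Data.Sign as Sign using (Sign)
import Data.Sign.Properties as Sign
open import Data.Sum using (_⊎_; inj₁; inj₂; [_,_])
open import Data.Sum.Function.Propositional using (_⊎-cong_)
open import Function using (_∘_; _⇔_; mk⇔; Equivalence)
open import Function.Properties.Equivalence using () renaming (trans to ⇔-trans; sym to ⇔-sym)
open import Level using (0ℓ)
open import Relation.Binary.Bundles using (Setoid; DecTotalOrder)
open import Relation.Binary.Core using (Rel)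
open import Relation.Binary.PropositionalEquality using (_≡_; _≢_; refl; sym; trans; cong; cong₂; subst; module ≡-Reasoning)
import Relation.Binary.Reasoning.Setoid as SetoidReasoning
open import Relation.Binary.Structures using (IsEquivalence)
open import Relation.Nullary.Decidable using (Dec; T?; dec-true; dec-false; yes; no)

module Plane where

  ℤ² : Set
  ℤ² = ℤ × ℤ

  det : ℤ² → ℤ² → ℤ
  det (a , c) (b , d) = a * d - b * c

  infixr 7 _·_
  _·_ : ℤ → ℤ² → ℤ²
  s · (x , y) = s * x , s * y

  infixl 6 _+ᵥ_
  _+ᵥ_ : ℤ² → ℤ² → ℤ²
  (x₁ , x₂) +ᵥ (y₁ , y₂) = x₁ + y₁ , x₂ + y₂

  ·-assoc : ∀ s t x → s · t · x ≡ (s * t) · x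
  ·-assoc s t (x₁ , x₂) = cong₂ _,_ (sym (ℤ.*-assoc s t x₁)) (sym (ℤ.*-assoc s t x₂))

  ·-identityˡ : ∀ x → + 1 · x ≡ x
  ·-identityˡ (x₁ , x₂) = cong₂ _,_ (ℤ.*-identityˡ x₁) (ℤ.*-identityˡ x₂)

  det-·ˡ : ∀ s x y → det (s · x) y ≡ s * det x y
  det-·ˡ s (x₁ , x₂) (y₁ , y₂) = by-ring s x₁ x₂ y₁ y₂
    where by-ring : ∀ s x₁ x₂ y₁ y₂ → (s * x₁) * y₂ - y₁ * (s * x₂) ≡ s * (x₁ * y₂ - y₁ * x₂)
          by-ring = solve-∀

  det-·ʳ : ∀ s x y → det x (s · y) ≡ s * det x y
  det-·ʳ s (x₁ , x₂) (y₁ , y₂) = by-ring s x₁ x₂ y₁ y₂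
    where by-ring : ∀ s x₁ x₂ y₁ y₂ → x₁ * (s * y₂) - (s * y₁) * x₂ ≡ s * (x₁ * y₂ - y₁ * x₂)
          by-ring = solve-∀

  det-antisym : ∀ x y → det x y ≡ - det y x
  det-antisym (x₁ , x₂) (y₁ , y₂) = by-ring x₁ x₂ y₁ y₂
    where by-ring : ∀ x₁ x₂ y₁ y₂ → x₁ * y₂ - y₁ * x₂ ≡ - (y₁ * x₂ - x₁ * y₂)
          by-ring = solve-∀

  det[x,tx+u]≡det[x,u] : ∀ t x u → det x (t · x +ᵥ u) ≡ det x u
  det[x,tx+u]≡det[x,u] t (x₁ , x₂) (u₁ , u₂) = by-ring t x₁ x₂ u₁ u₂
    where by-ring : ∀ t x₁ x₂ u₁ u₂ → x₁ * (t * x₂ + u₂) - (t * x₁ + u₁) * x₂ ≡ x₁ * u₂ - u₁ * x₂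
          by-ring = solve-∀

  det[tx+u,u]≡t*det[x,u] : ∀ t x u → det (t · x +ᵥ u) u ≡ t * det x u
  det[tx+u,u]≡t*det[x,u] t (x₁ , x₂) (u₁ , u₂) = by-ring t x₁ x₂ u₁ u₂
    where by-ring : ∀ t x₁ x₂ u₁ u₂ → (t * x₁ + u₁) * u₂ - u₁ * (t * x₂ + u₂) ≡ t * (x₁ * u₂ - u₁ * x₂)
          by-ring = solve-∀

  cramer : ∀ v u e → det v u · e ≡ det e u · v +ᵥ det v e · u
  cramer (a , c) (b , d) (e , f) = cong₂ _,_ (first a c b d e f) (second a c b d e f)
    where
      first : ∀ a c b d e f → (a * d - b * c) * e ≡ (e * d - b * f) * a + (a * f - e * c) * b
      first = solve-∀
      second : ∀ a c b d e f → (a * d - b * c) * f ≡ (e * d - b * f) * c + (a * f - e * c) * d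
      second = solve-∀

open Plane

◃1-* : ∀ s t → (s ◃ 1) * (t ◃ 1) ≡ (s Sign.* t) ◃ 1
◃1-* s t = sym (ℤ.◃-distrib-* s t 1 1)

◃1-square : ∀ s → (s ◃ 1) * (s ◃ 1) ≡ + 1
◃1-square s = trans (◃1-* s s) (cong (_◃ 1) (Sign.s*s≡+ s))

◃1-·-· : ∀ s t x → (s ◃ 1) · (t ◃ 1) · x ≡ ((s Sign.* t) ◃ 1) · x
◃1-·-· s t x = trans (·-assoc (s ◃ 1) (t ◃ 1) x) (cong (_· x) (◃1-* s t))

◃1-·-square : ∀ s x → (s ◃ 1) · (s ◃ 1) · x ≡ x
◃1-·-square s x = trans (·-assoc (s ◃ 1) (s ◃ 1) x) (trans (cong (_· x) (◃1-square s)) (·-identityˡ x))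

bézout : ∀ m k → ∃[ α ] ∃[ β ] α * + m + β * + k ≡ + gcd m k
bézout m k = fromIdentity (Bézout.identity (gcd-GCD m k))
  where
    pos-cong : ∀ d y j x i → d ℕ.+ y ℕ.* j ≡ x ℕ.* i → + d + + y * + j ≡ + x * + i
    pos-cong d y j x i eq = begin
      + d + + y * + j      ≡⟨ cong (_+_ (+ d)) (ℤ.pos-* y j) ⟨
      + d + + (y ℕ.* j)    ≡⟨ ℤ.pos-+ d (y ℕ.* j) ⟨
      + (d ℕ.+ y ℕ.* j)    ≡⟨ cong +_ eq ⟩
      + (x ℕ.* i)          ≡⟨ ℤ.pos-* x i ⟩
      + x * + i            ∎
      where open ≡-Reasoning
    cancel : ∀ d y j → - y * j + (d + y * j) ≡ d
    cancel = solve-∀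
    fromIdentity : ∀ {d} → Bézout.Identity.Identity d m k → ∃[ α ] ∃[ β ] α * + m + β * + k ≡ + d
    fromIdentity {d} (Bézout.Identity.+- x y eq) = + x , - + y , (begin
      + x * + m + - + y * + k                 ≡⟨ ℤ.+-comm (+ x * + m) (- + y * + k) ⟩
      - + y * + k + + x * + m                 ≡⟨ cong (_+_ (- + y * + k)) (pos-cong d y k x m eq) ⟨
      - + y * + k + (+ d + + y * + k)         ≡⟨ cancel (+ d) (+ y) (+ k) ⟩
      + d                                     ∎)
      where open ≡-Reasoning
    fromIdentity {d} (Bézout.Identity.-+ x y eq) = - + x , + y , (begin
      - + x * + m + + y * + k                 ≡⟨ cong (_+_ (- + x * + m)) (pos-cong d x m y k eq) ⟨
      - + x * + m + (+ d + + x * + m)         ≡⟨ cancel (+ d) (+ x) (+ m) ⟩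
      + d                                     ∎)
      where open ≡-Reasoning

T-⇔⇒≡ : ∀ {b b′} → T b ⇔ T b′ → b ≡ b′
T-⇔⇒≡ {false} {false} _    = refl
T-⇔⇒≡ {false} {true}  b⇔b′ = ⊥-elim (Equivalence.from b⇔b′ _)
T-⇔⇒≡ {true}  {false} b⇔b′ = ⊥-elim (Equivalence.to b⇔b′ _)
T-⇔⇒≡ {true}  {true}  _    = refl

T-≡ᵇ : ∀ {m n} → T (m ℕ.≡ᵇ n) ⇔ m ≡ n
T-≡ᵇ {m} {n} = mk⇔ (ℕ.≡ᵇ⇒≡ m n) (ℕ.≡⇒≡ᵇ m n)

T-<ᵇ : ∀ {m n} → T (m ℕ.<ᵇ n) ⇔ (m ≤ n × m ≢ n)
T-<ᵇ {m} {n} = mk⇔ (λ m<ᵇn → ℕ.<⇒≤ (ℕ.<ᵇ⇒< m n m<ᵇn) , ℕ.<⇒≢ (ℕ.<ᵇ⇒< m n m<ᵇn))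
                   (λ (m≤n , m≢n) → ℕ.<⇒<ᵇ (ℕ.≤∧≢⇒< m≤n m≢n))

T-<ᵇ∨≡ᵇ : ∀ {m n} → T ((m ℕ.<ᵇ n) ∨ (m ℕ.≡ᵇ n)) ⇔ m ≤ n
T-<ᵇ∨≡ᵇ {m} {n} = ⇔-trans T-∨ (mk⇔ to from)
  where
    to : T (m ℕ.<ᵇ n) ⊎ T (m ℕ.≡ᵇ n) → m ≤ n
    to = [ ℕ.<⇒≤ ∘ ℕ.<ᵇ⇒< m n , ℕ.≤-reflexive ∘ ℕ.≡ᵇ⇒≡ m n ]
    from : m ≤ n → T (m ℕ.<ᵇ n) ⊎ T (m ℕ.≡ᵇ n)
    from = [ inj₁ ∘ ℕ.<⇒<ᵇ , inj₂ ∘ ℕ.≡⇒≡ᵇ m n ] ∘ ℕ.m≤n⇒m<n∨m≡n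

open DecTotalOrder (×-decTotalOrder ℕ.≤-decTotalOrder ℕ.≤-decTotalOrder)
  using () renaming (_≤_ to _≤ₗₑₓ_; antisym to ≤ₗₑₓ-antisym; total to ≤ₗₑₓ-total)

unique∧set⇒length≡ : ∀ {A : Set} {xs ys : List A} → Unique xs → Unique ys → xs ∼[ set ] ys → length xs ≡ length ys
unique∧set⇒length≡ uxs uys xs∼ys = ↭-length (∼bag⇒↭ (unique∧set⇒bag uxs uys xs∼ys))

lookup-injective : ∀ {A : Set} {xs : List A} → Unique xs → ∀ i j → lookup xs i ≡ lookup xs j → i ≡ j
lookup-injective (_  ∷ _)   zero    zero    _  = refl
lookup-injective (x∉ ∷ _)   zero    (suc j) x≡ = ⊥-elim (All.lookup x∉ (∈-lookup j) x≡)
lookup-injective (x∉ ∷ _)   (suc i) zero    ≡x = ⊥-elim (All.lookup x∉ (∈-lookup i) (sym ≡x))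
lookup-injective (_  ∷ uxs) (suc i) (suc j) eq = cong suc (lookup-injective uxs i j eq)

map-lookup-allFin : ∀ {A B : Set} (f : A → B) xs → map (f ∘ lookup xs) (allFin (length xs)) ≡ map f xs
map-lookup-allFin f xs = begin
  map (f ∘ lookup xs) (allFin (length xs))  ≡⟨ map-tabulate (λ i → i) (f ∘ lookup xs) ⟩
  tabulate (f ∘ lookup xs)                  ≡⟨ map-tabulate (lookup xs) f ⟨
  map f (tabulate (lookup xs))              ≡⟨ cong (map f) (tabulate-lookup xs) ⟩
  map f xs                                  ∎
  where open ≡-Reasoning

-- Defs.sumℤ n, without its spurious parameter n.
sumℤ′ : List ℤ → ℤ
sumℤ′ = foldr _+_ (+ 0)

𝟙 : Bool → ℤ
𝟙 b = if b then + 1 else + 0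

𝟙-square : ∀ b → 𝟙 b * 𝟙 b ≡ 𝟙 b
𝟙-square false = refl
𝟙-square true  = refl

𝟙-*-disjoint : ∀ {a b} → (T a → T b → ⊥) → 𝟙 a * 𝟙 b ≡ + 0
𝟙-*-disjoint {false} {_}     _        = refl
𝟙-*-disjoint {true}  {false} _        = refl
𝟙-*-disjoint {true}  {true}  disjoint = ⊥-elim (disjoint _ _)

sum-𝟙≡length-filter : ∀ {A : Set} (p : A → Bool) xs → sumℤ′ (map (𝟙 ∘ p) xs) ≡ + length (filterᵇ p xs)
sum-𝟙≡length-filter p []       = refl
sum-𝟙≡length-filter p (x ∷ xs) with p x
... | true  = trans (cong (_+_ (+ 1)) (sum-𝟙≡length-filter p xs)) (sym (ℤ.pos-+ 1 _))
... | false = trans (ℤ.+-identityˡ _) (sum-𝟙≡length-filter p xs)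

sum-zero : ∀ {A : Set} (f : A → ℤ) xs → (∀ x → f x ≡ + 0) → sumℤ′ (map f xs) ≡ + 0
sum-zero f []       _   = refl
sum-zero f (x ∷ xs) f≡0 = cong₂ _+_ (f≡0 x) (sum-zero f xs f≡0)

module Congruence (n : ℕ) .{{_ : NonZero n}} where

  infix 4 _≈_ _≈²_ _≈±_

  data _≈_ (x y : ℤ) : Set where
    _,_ : (k : ℤ) → x ≡ y + k * + n → x ≈ y

  ≈-reflexive : ∀ {x y} → x ≡ y → x ≈ y
  ≈-reflexive {x} refl = + 0 , by-ring x (+ n)
    where by-ring : ∀ x m → x ≡ x + + 0 * m
          by-ring = solve-∀

  ≈-refl : ∀ {x} → x ≈ x
  ≈-refl = ≈-reflexive refl

  ≈-sym : ∀ {x y} → x ≈ y → y ≈ x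
  ≈-sym {y = y} (k , refl) = - k , by-ring y k (+ n)
    where by-ring : ∀ y k m → y ≡ (y + k * m) + - k * m
          by-ring = solve-∀

  ≈-trans : ∀ {x y z} → x ≈ y → y ≈ z → x ≈ z
  ≈-trans {z = z} (k , refl) (l , refl) = l + k , by-ring z k l (+ n)
    where by-ring : ∀ z k l m → (z + l * m) + k * m ≡ z + (l + k) * m
          by-ring = solve-∀

  ≈-isEquivalence : IsEquivalence _≈_
  ≈-isEquivalence = record { refl = ≈-refl ; sym = ≈-sym ; trans = ≈-trans }

  ≈-setoid : Setoid 0ℓ 0ℓ
  ≈-setoid = record { isEquivalence = ≈-isEquivalence }

  +-cong : ∀ {x x′ y y′} → x ≈ x′ → y ≈ y′ → x + y ≈ x′ + y′
  +-cong {x′ = x′} {y′ = y′} (k , refl) (l , refl) = k + l , by-ring x′ y′ k l (+ n)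
    where by-ring : ∀ x y k l m → (x + k * m) + (y + l * m) ≡ (x + y) + (k + l) * m
          by-ring = solve-∀

  *-cong : ∀ {x x′ y y′} → x ≈ x′ → y ≈ y′ → x * y ≈ x′ * y′
  *-cong {x′ = x′} {y′ = y′} (k , refl) (l , refl) =
    k * y′ + x′ * l + k * l * + n , by-ring x′ y′ k l (+ n)
    where by-ring : ∀ x y k l m → (x + k * m) * (y + l * m) ≡ x * y + (k * y + x * l + k * l * m) * m
          by-ring = solve-∀

  -‿cong : ∀ {x y} → x ≈ y → - x ≈ - y
  -‿cong {y = y} (k , refl) = - k , by-ring y k (+ n)
    where by-ring : ∀ y k m → - (y + k * m) ≡ - y + - k * m
          by-ring = solve-∀

  n≈0 : + n ≈ + 0
  n≈0 = + 1 , by-ring (+ n)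
    where by-ring : ∀ m → m ≡ + 0 + + 1 * m
          by-ring = solve-∀

  n∸a≈-a : ∀ {a} → a ≤ n → + (n ℕ.∸ a) ≈ - + a
  n∸a≈-a {a} a≤n = begin
    + (n ℕ.∸ a)   ≡⟨ trans (ℤ.m-n≡m⊖n n a) (ℤ.≤-⊖ a≤n) ⟨
    + n - + a     ≈⟨ +-cong n≈0 (≈-refl { - + a}) ⟩
    + 0 - + a     ≡⟨ ℤ.+-identityˡ (- + a) ⟩
    - + a         ∎
    where open SetoidReasoning ≈-setoid

  private
    n≤r : ∀ {r s} m → + r ≡ + s + + suc m * + n → n ≤ r
    n≤r {r} {s} m eq = begin
      n                  ≤⟨ ℕ.m≤m+n n (m ℕ.* n) ⟩
      suc m ℕ.* n        ≤⟨ ℕ.m≤n+m (suc m ℕ.* n) s ⟩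
      s ℕ.+ suc m ℕ.* n  ≡⟨ ℤ.+-injective (trans (ℤ.pos-+ s _) (trans (cong (_+_ (+ s)) pos-*) (sym eq))) ⟩
      r                  ∎
      where
        open ℕ.≤-Reasoning
        pos-* : + (suc m ℕ.* n) ≡ + suc m * + n
        pos-* = ℤ.pos-* (suc m) n

  residue-≈⇒≡ : ∀ {r s} → r < n → s < n → + r ≈ + s → r ≡ s
  residue-≈⇒≡ {s = s} _ _ (+ zero , eq) = ℤ.+-injective (trans eq (by-ring (+ s) (+ n)))
    where by-ring : ∀ x m → x + + 0 * m ≡ x
          by-ring = solve-∀
  residue-≈⇒≡ r<n _ (+ suc m , eq) = ⊥-elim (ℕ.<⇒≱ r<n (n≤r m eq))
  residue-≈⇒≡ {r} {s} _ s<n (-[1+ m ] , eq) =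
    ⊥-elim (ℕ.<⇒≱ s<n (n≤r m (swap (+ r) (+ s) (+ suc m) (+ n) eq)))
    where
      by-ring : ∀ y k m → y ≡ (y + - k * m) + k * m
      by-ring = solve-∀
      swap : ∀ x y k m → x ≡ y + - k * m → y ≡ x + k * m
      swap _ y k m refl = by-ring y k m

  %ℕ-≈ : ∀ x → + (x %ℕ n) ≈ x
  %ℕ-≈ x = ≈-sym (x /ℕ n , a≡a%ℕn+[a/ℕn]*n x n)

  ≈-residue⇒%ℕ≡ : ∀ {x r} → r < n → x ≈ + r → x %ℕ n ≡ r
  ≈-residue⇒%ℕ≡ {x} r<n x≈r = residue-≈⇒≡ (n%ℕd<d x n) r<n (≈-trans (%ℕ-≈ x) x≈r)

  IsSign : ℤ → Set
  IsSign x = ∃[ s ] x ≈ s ◃ 1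

  IsSign-resp-≈ : ∀ {x y} → x ≈ y → IsSign x → IsSign y
  IsSign-resp-≈ x≈y (s , x≈s) = s , ≈-trans (≈-sym x≈y) x≈s

  IsSign-neg : ∀ {x} → IsSign x → IsSign (- x)
  IsSign-neg (s , x≈s) = Sign.opposite s , ≈-trans (-‿cong x≈s) (≈-reflexive (-◃1 s))
    where
      -◃1 : ∀ s → - (s ◃ 1) ≡ Sign.opposite s ◃ 1
      -◃1 Sign.+ = refl
      -◃1 Sign.- = refl

  IsSign-* : ∀ {x} s → IsSign x → IsSign ((s ◃ 1) * x)
  IsSign-* s (t , x≈t) = s Sign.* t , ≈-trans (*-cong (≈-refl {s ◃ 1}) x≈t) (≈-reflexive (◃1-* s t))

  residue⇔IsSign : 2 ≤ n → ∀ x → (x %ℕ n ≡ 1 ⊎ x %ℕ n ≡ n ℕ.∸ 1) ⇔ IsSign x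
  residue⇔IsSign 2≤n x = mk⇔ to from
    where
      1≤n : 1 ≤ n
      1≤n = ℕ.≤-trans (ℕ.s≤s ℕ.z≤n) 2≤n
      n∸1<n : n ℕ.∸ 1 < n
      n∸1<n = ℕ.∸-monoʳ-< {n} {1} {0} ℕ.z<s 1≤n
      to : x %ℕ n ≡ 1 ⊎ x %ℕ n ≡ n ℕ.∸ 1 → IsSign x
      to (inj₁ x%n≡1)   = Sign.+ , ≈-trans (≈-sym (%ℕ-≈ x)) (≈-reflexive (cong +_ x%n≡1))
      to (inj₂ x%n≡n-1) = Sign.- , ≈-trans (≈-sym (%ℕ-≈ x)) (≈-trans (≈-reflexive (cong +_ x%n≡n-1)) (n∸a≈-a 1≤n))
      from : IsSign x → x %ℕ n ≡ 1 ⊎ x %ℕ n ≡ n ℕ.∸ 1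
      from (Sign.+ , x≈1)  = inj₁ (≈-residue⇒%ℕ≡ 2≤n x≈1)
      from (Sign.- , x≈-1) = inj₂ (≈-residue⇒%ℕ≡ n∸1<n (≈-trans x≈-1 (≈-sym (n∸a≈-a 1≤n))))

  _≈²_ : Rel ℤ² 0ℓ
  _≈²_ = Pointwise _≈_ _≈_

  ≈²-setoid : Setoid 0ℓ 0ℓ
  ≈²-setoid = ×-setoid ≈-setoid ≈-setoid

  ≈²-reflexive : ∀ {x y} → x ≡ y → x ≈² y
  ≈²-reflexive = Setoid.reflexive ≈²-setoid

  ≈²-refl : ∀ {x} → x ≈² x
  ≈²-refl = ≈-refl , ≈-refl

  ≈²-sym : ∀ {x y} → x ≈² y → y ≈² x
  ≈²-sym = Setoid.sym ≈²-setoid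

  ≈²-trans : ∀ {x y z} → x ≈² y → y ≈² z → x ≈² z
  ≈²-trans = Setoid.trans ≈²-setoid

  det-cong : ∀ {x x′ y y′} → x ≈² x′ → y ≈² y′ → det x y ≈ det x′ y′
  det-cong (x₁ , x₂) (y₁ , y₂) = +-cong (*-cong x₁ y₂) (-‿cong (*-cong y₁ x₂))

  ·-cong : ∀ {s s′ x x′} → s ≈ s′ → x ≈² x′ → s · x ≈² s′ · x′
  ·-cong s≈s′ (x₁ , x₂) = *-cong s≈s′ x₁ , *-cong s≈s′ x₂

  +ᵥ-cong : ∀ {x x′ y y′} → x ≈² x′ → y ≈² y′ → x +ᵥ y ≈² x′ +ᵥ y′
  +ᵥ-cong (x₁ , x₂) (y₁ , y₂) = +-cong x₁ y₁ , +-cong x₂ y₂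

  cramer-≈ : ∀ {v u e δ ε} → det v u ≈ δ → det v e ≈ ε → δ · e ≈² det e u · v +ᵥ ε · u
  cramer-≈ {v} {u} {e} {δ} {ε} det[v,u]≈δ det[v,e]≈ε = begin
    δ · e                        ≈⟨ ·-cong (≈-sym det[v,u]≈δ) (≈²-refl {e}) ⟩
    det v u · e                  ≡⟨ cramer v u e ⟩
    det e u · v +ᵥ det v e · u   ≈⟨ +ᵥ-cong (≈²-refl {det e u · v}) (·-cong det[v,e]≈ε (≈²-refl {u})) ⟩
    det e u · v +ᵥ ε · u         ∎
    where open SetoidReasoning ≈²-setoid

  data _≈±_ (x y : ℤ²) : Set where
    _,_ : (s : Sign) → x ≈² (s ◃ 1) · y → x ≈± y

  ≈²⇒≈± : ∀ {x y} → x ≈² y → x ≈± y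
  ≈²⇒≈± {y = y} x≈y = Sign.+ , ≈²-trans x≈y (≈²-reflexive (sym (·-identityˡ y)))

  ≈±-sym : ∀ {x y} → x ≈± y → y ≈± x
  ≈±-sym {x} {y} (s , x≈sy) = s , (begin
    y                        ≡⟨ ◃1-·-square s y ⟨
    (s ◃ 1) · (s ◃ 1) · y    ≈⟨ ·-cong (≈-refl {s ◃ 1}) (≈²-sym x≈sy) ⟩
    (s ◃ 1) · x              ∎)
    where open SetoidReasoning ≈²-setoid

  ≈±-trans : ∀ {x y z} → x ≈± y → y ≈± z → x ≈± z
  ≈±-trans {x} {y} {z} (s , x≈sy) (t , y≈tz) = s Sign.* t , (begin
    x                        ≈⟨ x≈sy ⟩
    (s ◃ 1) · y              ≈⟨ ·-cong (≈-refl {s ◃ 1}) y≈tz ⟩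
    (s ◃ 1) · (t ◃ 1) · z    ≡⟨ ◃1-·-· s t z ⟩
    ((s Sign.* t) ◃ 1) · z   ∎)
    where open SetoidReasoning ≈²-setoid

  IsSign-det-swap : ∀ {x y} → IsSign (det x y) → IsSign (det y x)
  IsSign-det-swap {x} {y} = IsSign-resp-≈ (≈-reflexive (sym (det-antisym y x))) ∘ IsSign-neg

  IsSign-det-≈± : ∀ {x y y′} → y ≈± y′ → IsSign (det x y′) → IsSign (det x y)
  IsSign-det-≈± {x} {y} {y′} (s , y≈sy′) det[x,y′]-sign = IsSign-resp-≈
    (≈-sym (≈-trans (det-cong (≈²-refl {x}) y≈sy′) (≈-reflexive (det-·ʳ (s ◃ 1) x y′))))
    (IsSign-* s det[x,y′]-sign)

  common-neighbour⇒≈± : ∀ {v w u} → det v w ≈ + 0 → IsSign (det v u) → IsSign (det w u) → w ≈± v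
  common-neighbour⇒≈± {v} {w} {u} det[v,w]≈0 (s , det[v,u]≈s) (t , det[w,u]≈t) =
    ≈±-trans (≈±-sym (s , ≈²-refl)) (≈±-trans (≈²⇒≈± sw≈tv) (t , ≈²-refl))
    where
      sw≈tv : (s ◃ 1) · w ≈² (t ◃ 1) · v
      sw≈tv = begin
        (s ◃ 1) · w                ≈⟨ cramer-≈ {v} {u} det[v,u]≈s det[v,w]≈0 ⟩
        det w u · v +ᵥ + 0 · u     ≈⟨ +ᵥ-cong (·-cong det[w,u]≈t (≈²-refl {v})) (≈²-refl {+ 0 · u}) ⟩
        (t ◃ 1) · v +ᵥ + 0 · u     ≡⟨ cong₂ _,_ (ℤ.+-identityʳ _) (ℤ.+-identityʳ _) ⟩
        (t ◃ 1) · v                ∎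
        where open SetoidReasoning ≈²-setoid

module Vertices (n : ℕ) .{{_ : NonZero n}} where

  open Congruence n

  ι : ℕ × ℕ → ℤ²
  ι (a , c) = + a , + c

  Reduced : ℕ × ℕ → Set
  Reduced (a , c) = a < n × c < n

  ≈²⇒≡ : ∀ {p q} → Reduced p → Reduced q → ι p ≈² ι q → p ≡ q
  ≈²⇒≡ (a<n , c<n) (b<n , d<n) (a≈b , c≈d) = cong₂ _,_ (residue-≈⇒≡ a<n b<n a≈b) (residue-≈⇒≡ c<n d<n c≈d)

  reduce : ℤ² → ℕ × ℕ
  reduce (x , y) = x %ℕ n , y %ℕ n

  reduce-reduced : ∀ x → Reduced (reduce x)
  reduce-reduced (x , y) = n%ℕd<d x n , n%ℕd<d y n

  ι-reduce : ∀ x → ι (reduce x) ≈² x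
  ι-reduce (x , y) = %ℕ-≈ x , %ℕ-≈ y

  negPair : ℕ × ℕ → ℕ × ℕ
  negPair (a , c) = negMod n a , negMod n c

  negPair-reduced : ∀ p → Reduced (negPair p)
  negPair-reduced (a , c) = n%ℕd<d (+ (n ℕ.∸ a)) n , n%ℕd<d (+ (n ℕ.∸ c)) n

  ι-negPair : ∀ {p} → Reduced p → ι (negPair p) ≈² (Sign.- ◃ 1) · ι p
  ι-negPair {a , c} (a<n , c<n) = negMod-≈ a<n , negMod-≈ c<n
    where
      negMod-≈ : ∀ {b} → b < n → + negMod n b ≈ (Sign.- ◃ 1) * + b
      negMod-≈ {b} b<n =
        ≈-trans (%ℕ-≈ (+ (n ℕ.∸ b))) (≈-trans (n∸a≈-a (ℕ.<⇒≤ b<n)) (≈-reflexive (sym (ℤ.-1*i≡-i (+ b)))))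

  negPair-involutive : ∀ {p} → Reduced p → negPair (negPair p) ≡ p
  negPair-involutive {p} rp = ≈²⇒≡ (negPair-reduced (negPair p)) rp (begin
    ι (negPair (negPair p))              ≈⟨ ι-negPair (negPair-reduced p) ⟩
    (Sign.- ◃ 1) · ι (negPair p)         ≈⟨ ·-cong (≈-refl {Sign.- ◃ 1}) (ι-negPair rp) ⟩
    (Sign.- ◃ 1) · (Sign.- ◃ 1) · ι p    ≡⟨ ◃1-·-square Sign.- (ι p) ⟩
    ι p                                  ∎)
    where open SetoidReasoning ≈²-setoid

  canonical⇔ : ∀ p → T (canonical n p) ⇔ p ≤ₗₑₓ negPair p
  canonical⇔ _ = ⇔-trans T-∨ (T-<ᵇ ⊎-cong ⇔-trans T-∧ (T-≡ᵇ ×-cong T-<ᵇ∨≡ᵇ))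

  canonical-negPair⇒≡ : ∀ {p} → Reduced p → T (canonical n p) → T (canonical n (negPair p)) → negPair p ≡ p
  canonical-negPair⇒≡ {p} rp cp cnp = sym (≡×≡⇒≡ (≤ₗₑₓ-antisym p≤np np≤p))
    where
      p≤np : p ≤ₗₑₓ negPair p
      p≤np = Equivalence.to (canonical⇔ p) cp
      np≤p : negPair p ≤ₗₑₓ p
      np≤p = subst (negPair p ≤ₗₑₓ_) (negPair-involutive rp) (Equivalence.to (canonical⇔ (negPair p)) cnp)

  canonical-≈±⇒≡ : ∀ {p q} → Reduced p → Reduced q → T (canonical n p) → T (canonical n q) → ι p ≈± ι q → p ≡ q
  canonical-≈±⇒≡ {q = q} rp rq _ _ (Sign.+ , p≈q) = ≈²⇒≡ rp rq (≈²-trans p≈q (≈²-reflexive (·-identityˡ (ι q))))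
  canonical-≈±⇒≡ {p} {q} rp rq cp cq (Sign.- , p≈-q) =
    trans p≡nq (canonical-negPair⇒≡ rq cq (subst (T ∘ canonical n) p≡nq cp))
    where
      p≡nq : p ≡ negPair q
      p≡nq = ≈²⇒≡ rp (negPair-reduced q) (≈²-trans p≈-q (≈²-sym (ι-negPair rq)))

  canonicalRep : ℕ × ℕ → ℕ × ℕ
  canonicalRep p = if canonical n p then p else negPair p

  canonicalRep-reduced : ∀ {p} → Reduced p → Reduced (canonicalRep p)
  canonicalRep-reduced {p} rp with canonical n p
  ... | true  = rp
  ... | false = negPair-reduced p

  canonicalRep-canonical : ∀ {p} → Reduced p → T (canonical n (canonicalRep p))
  canonicalRep-canonical {p} rp with canonical n p in eq | ≤ₗₑₓ-total p (negPair p)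
  ... | true  | _         = subst T (sym eq) _
  ... | false | inj₁ p≤np = ⊥-elim (subst T eq (Equivalence.from (canonical⇔ p) p≤np))
  ... | false | inj₂ np≤p =
    Equivalence.from (canonical⇔ (negPair p)) (subst (negPair p ≤ₗₑₓ_) (sym (negPair-involutive rp)) np≤p)

  canonicalRep-≈± : ∀ {p} → Reduced p → ι (canonicalRep p) ≈± ι p
  canonicalRep-≈± {p} rp with canonical n p
  ... | true  = ≈²⇒≈± ≈²-refl
  ... | false = Sign.- , ι-negPair rp

  vertexOf : ℤ² → ℕ × ℕ
  vertexOf x = canonicalRep (reduce x)

  vertexOf-reduced : ∀ x → Reduced (vertexOf x)
  vertexOf-reduced x = canonicalRep-reduced (reduce-reduced x)

  vertexOf-canonical : ∀ x → T (canonical n (vertexOf x))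
  vertexOf-canonical x = canonicalRep-canonical (reduce-reduced x)

  vertexOf-≈± : ∀ x → ι (vertexOf x) ≈± x
  vertexOf-≈± x = ≈±-trans (canonicalRep-≈± (reduce-reduced x)) (≈²⇒≈± (ι-reduce x))

  isVertex? : ℕ × ℕ → Bool
  isVertex? p = primitive? n p ∧ canonical n p

  IsVertex : ℕ × ℕ → Set
  IsVertex p = Reduced p × T (primitive? n p) × T (canonical n p)

  ∈-vertices⇔ : ∀ {p} → p ∈ vertices n ⇔ IsVertex p
  ∈-vertices⇔ {p} = mk⇔ to from
    where
      to : p ∈ vertices n → IsVertex p
      to p∈vs with ∈-filter⁻ (T? ∘ isVertex?) {xs = cartesianProduct (upTo n) (upTo n)} p∈vs
      ... | p∈n² , prim∧can with ∈-cartesianProduct⁻ (upTo n) (upTo n) p∈n²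
      ...   | a∈ , c∈ = (∈-upTo⁻ a∈ , ∈-upTo⁻ c∈) , Equivalence.to T-∧ prim∧can
      from : IsVertex p → p ∈ vertices n
      from ((a<n , c<n) , prim×can) =
        ∈-filter⁺ (T? ∘ isVertex?) (∈-cartesianProduct⁺ (∈-upTo⁺ a<n) (∈-upTo⁺ c<n)) (Equivalence.from T-∧ prim×can)

  vertices-unique : Unique (vertices n)
  vertices-unique = filter⁺ (T? ∘ isVertex?) (cartesianProduct⁺ (upTo⁺ n) (upTo⁺ n))

  det-ι : ∀ a c b d → + (a ℕ.* d) - + (b ℕ.* c) ≡ det (ι (a , c)) (ι (b , d))
  det-ι a c b d = cong₂ _-_ (ℤ.pos-* a d) (ℤ.pos-* b c)

  detMod≡0⇒det≈0 : ∀ v w → detMod n v w ≡ 0 → det (ι v) (ι w) ≈ + 0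
  detMod≡0⇒det≈0 (a , c) (b , d) detMod≡0 =
    ≈-trans (≈-reflexive (sym (det-ι a c b d))) (≈-trans (≈-sym (%ℕ-≈ _)) (≈-reflexive (cong +_ detMod≡0)))

  adjacent⇔IsSign : 2 ≤ n → ∀ v w → T (adjacent n v w) ⇔ IsSign (det (ι v) (ι w))
  adjacent⇔IsSign 2≤n (a , c) (b , d) =
    ⇔-trans T-∨ (⇔-trans (T-≡ᵇ ⊎-cong T-≡ᵇ) (⇔-trans (residue⇔IsSign 2≤n _)
      (mk⇔ (IsSign-resp-≈ (≈-reflexive (det-ι a c b d))) (IsSign-resp-≈ (≈-reflexive (sym (det-ι a c b d)))))))

  adjacent-sym : 2 ≤ n → ∀ v w → adjacent n v w ≡ adjacent n w v
  adjacent-sym 2≤n v w = T-⇔⇒≡ (⇔-trans (adjacent⇔IsSign 2≤n v w)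
    (⇔-trans (mk⇔ (IsSign-det-swap {ι v} {ι w}) (IsSign-det-swap {ι w} {ι v})) (⇔-sym (adjacent⇔IsSign 2≤n w v))))

  IsSign-det⇒primitive : ∀ v w → IsSign (det (ι v) (ι w)) → T (primitive? n w)
  IsSign-det⇒primitive (a , c) (b , d) (s , k , det≡s+kn) = ℕ.≡⇒≡ᵇ g 1 (∣1⇒≡1 g∣1)
    where
      g : ℕ
      g = gcd (gcd b d) n
      g∣b : + g ∣ + b
      g∣b = ∣ᵤ⇒∣ (∣-trans (gcd[m,n]∣m (gcd b d) n) (gcd[m,n]∣m b d))
      g∣d : + g ∣ + d
      g∣d = ∣ᵤ⇒∣ (∣-trans (gcd[m,n]∣m (gcd b d) n) (gcd[m,n]∣n b d))
      g∣n : + g ∣ + n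
      g∣n = ∣ᵤ⇒∣ (gcd[m,n]∣n (gcd b d) n)
      g∣s+kn : + g ∣ (s ◃ 1) + k * + n
      g∣s+kn = subst (+ g ∣_) det≡s+kn (∣m∣n⇒∣m-n (∣n⇒∣m*n (+ a) g∣d) (∣m⇒∣m*n (+ c) g∣b))
      g∣1 : g ∣ℕ 1
      g∣1 = subst (g ∣ℕ_) (ℤ.abs-◃ s 1) (∣⇒∣ᵤ (∣m+n∣n⇒∣m {m = s ◃ 1} g∣s+kn (∣n⇒∣m*n k g∣n)))

  primitive⇒partner : ∀ v → T (primitive? n v) → ∃[ u ] det (ι v) u ≈ + 1
  primitive⇒partner (a , c) prim with bézout a c | bézout (gcd a c) n
  ... | α , β , αa+βc≡g | γ , δ , γg+δn≡1 = (- (γ * β) , γ * α) , (- δ , (begin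
    + a * (γ * α) - - (γ * β) * + c                ≡⟨ by-ring (+ a) (+ c) α β γ δ (+ n) ⟩
    γ * (α * + a + β * + c) + δ * + n + - δ * + n  ≡⟨ cong (λ z → γ * z + δ * + n + - δ * + n) αa+βc≡g ⟩
    γ * + gcd a c + δ * + n + - δ * + n            ≡⟨ cong (_+ - δ * + n) γg+δn≡1 ⟩
    + gcd (gcd a c) n + - δ * + n                  ≡⟨ cong (λ g → + g + - δ * + n) (ℕ.≡ᵇ⇒≡ _ 1 prim) ⟩
    + 1 + - δ * + n                                ∎))
    where
      open ≡-Reasoning
      by-ring : ∀ a c α β γ δ m → a * (γ * α) - - (γ * β) * c ≡ γ * (α * a + β * c) + δ * m + - δ * m
      by-ring = solve-∀

  common-neighbour⇒≡ : 2 ≤ n → ∀ {v w} u → IsVertex v → IsVertex w → det (ι v) (ι w) ≈ + 0 →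
                       T (adjacent n v u) → T (adjacent n u w) → v ≡ w
  common-neighbour⇒≡ 2≤n {v} {w} u (rv , _ , cv) (rw , _ , cw) det[v,w]≈0 v~u u~w =
    sym (canonical-≈±⇒≡ rw rv cw cv (common-neighbour⇒≈± {ι v} {ι w} {ι u} det[v,w]≈0
      (Equivalence.to (adjacent⇔IsSign 2≤n v u) v~u)
      (IsSign-det-swap {ι u} {ι w} (Equivalence.to (adjacent⇔IsSign 2≤n u w) u~w))))

  module Neighbours (2≤n : 2 ≤ n) (v : ℕ × ℕ) (u₀ : ℤ²) (det[v,u₀]≈1 : det (ι v) u₀ ≈ + 1) where

    line : ℤ → ℤ²
    line t = t · ι v +ᵥ u₀

    det[v,line]≈1 : ∀ t → det (ι v) (line t) ≈ + 1
    det[v,line]≈1 t = ≈-trans (≈-reflexive (det[x,tx+u]≡det[x,u] t (ι v) u₀)) det[v,u₀]≈1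

    det[line,u₀]≈t : ∀ t → det (line t) u₀ ≈ t
    det[line,u₀]≈t t = ≈-trans (≈-reflexive (det[tx+u,u]≡t*det[x,u] t (ι v) u₀))
      (≈-trans (*-cong (≈-refl {t}) det[v,u₀]≈1) (≈-reflexive (ℤ.*-identityʳ t)))

    line-≈±⇒≈ : ∀ {t t′} → line t ≈± line t′ → t ≈ t′
    line-≈±⇒≈ {t} {t′} (s , ℓ≈sℓ′) = begin
      t                              ≈⟨ det[line,u₀]≈t t ⟨
      det (line t) u₀                ≈⟨ det-cong ℓ≈sℓ′ (≈²-refl {u₀}) ⟩
      det ((s ◃ 1) · line t′) u₀     ≡⟨ det-·ˡ (s ◃ 1) (line t′) u₀ ⟩
      (s ◃ 1) * det (line t′) u₀     ≈⟨ *-cong s≈1 (det[line,u₀]≈t t′) ⟩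
      + 1 * t′                       ≡⟨ ℤ.*-identityˡ t′ ⟩
      t′                             ∎
      where
        open SetoidReasoning ≈-setoid
        s≈1 : s ◃ 1 ≈ + 1
        s≈1 = begin
          s ◃ 1                           ≡⟨ ℤ.*-identityʳ (s ◃ 1) ⟨
          (s ◃ 1) * + 1                   ≈⟨ *-cong (≈-refl {s ◃ 1}) (det[v,line]≈1 t′) ⟨
          (s ◃ 1) * det (ι v) (line t′)   ≡⟨ det-·ʳ (s ◃ 1) (ι v) (line t′) ⟨
          det (ι v) ((s ◃ 1) · line t′)   ≈⟨ det-cong (≈²-refl {ι v}) ℓ≈sℓ′ ⟨
          det (ι v) (line t)              ≈⟨ det[v,line]≈1 t ⟩
          + 1                             ∎

    det≈1⇒on-line : ∀ {x} → det (ι v) x ≈ + 1 → x ≈² line (det x u₀)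
    det≈1⇒on-line {x} det[v,x]≈1 = begin
      x                              ≡⟨ ·-identityˡ x ⟨
      + 1 · x                        ≈⟨ cramer-≈ det[v,u₀]≈1 det[v,x]≈1 ⟩
      det x u₀ · ι v +ᵥ + 1 · u₀     ≡⟨ cong (det x u₀ · ι v +ᵥ_) (·-identityˡ u₀) ⟩
      line (det x u₀)                ∎
      where open SetoidReasoning ≈²-setoid

    neighbour : ℕ → ℕ × ℕ
    neighbour t = vertexOf (line (+ t))

    IsSign-det[v,neighbour] : ∀ t → IsSign (det (ι v) (ι (neighbour t)))
    IsSign-det[v,neighbour] t = IsSign-det-≈± {ι v} (vertexOf-≈± (line (+ t))) (Sign.+ , det[v,line]≈1 (+ t))

    neighbour-isVertex : ∀ t → IsVertex (neighbour t)
    neighbour-isVertex t = vertexOf-reduced (line (+ t)) ,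
      IsSign-det⇒primitive v (neighbour t) (IsSign-det[v,neighbour] t) , vertexOf-canonical (line (+ t))

    neighbour-adjacent : ∀ t → T (adjacent n v (neighbour t))
    neighbour-adjacent t = Equivalence.from (adjacent⇔IsSign 2≤n v (neighbour t)) (IsSign-det[v,neighbour] t)

    neighbour-injective : ∀ {t t′} → t < n → t′ < n → neighbour t ≡ neighbour t′ → t ≡ t′
    neighbour-injective {t} {t′} t<n t′<n nb≡nb′ = residue-≈⇒≡ t<n t′<n (line-≈±⇒≈ (≈±-trans
      (≈±-sym (vertexOf-≈± (line (+ t))))
      (subst (λ p → ι p ≈± line (+ t′)) (sym nb≡nb′) (vertexOf-≈± (line (+ t′))))))

    neighbour-surjective : ∀ {w} → IsVertex w → T (adjacent n v w) → ∃[ t ] t < n × neighbour t ≡ w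
    neighbour-surjective {w} (rw , _ , cw) v~w with Equivalence.to (adjacent⇔IsSign 2≤n v w) v~w
    ... | s , det[v,w]≈s = τ %ℕ n , n%ℕd<d τ n ,
      canonical-≈±⇒≡ (vertexOf-reduced (line (+ (τ %ℕ n)))) rw (vertexOf-canonical (line (+ (τ %ℕ n)))) cw
        (≈±-trans (vertexOf-≈± (line (+ (τ %ℕ n)))) (≈±-trans (≈²⇒≈± line≈sw) (s , ≈²-refl)))
      where
        sw : ℤ²
        sw = (s ◃ 1) · ι w
        det[v,sw]≈1 : det (ι v) sw ≈ + 1
        det[v,sw]≈1 = ≈-trans (≈-reflexive (det-·ʳ (s ◃ 1) (ι v) (ι w)))
          (≈-trans (*-cong (≈-refl {s ◃ 1}) det[v,w]≈s) (≈-reflexive (◃1-square s)))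
        τ : ℤ
        τ = det sw u₀
        line≈sw : line (+ (τ %ℕ n)) ≈² sw
        line≈sw = ≈²-trans (+ᵥ-cong (·-cong (%ℕ-≈ τ) (≈²-refl {ι v})) (≈²-refl {u₀}))
                           (≈²-sym (det≈1⇒on-line det[v,sw]≈1))

    neighbours : List (ℕ × ℕ)
    neighbours = applyUpTo neighbour n

    neighbours-unique : Unique neighbours
    neighbours-unique = applyUpTo⁺₁ neighbour n λ t<t′ t′<n →
      ℕ.<⇒≢ t<t′ ∘ neighbour-injective (ℕ.<-trans t<t′ t′<n) t′<n

    ∈-neighbours⇔ : ∀ {w} → w ∈ filterᵇ (adjacent n v) (vertices n) ⇔ w ∈ neighbours
    ∈-neighbours⇔ {w} = mk⇔ to from
      where
        to : w ∈ filterᵇ (adjacent n v) (vertices n) → w ∈ neighbours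
        to w∈ =
          let w∈vs , v~w  = ∈-filter⁻ (T? ∘ adjacent n v) {xs = vertices n} w∈
              t , t<n , nb≡w = neighbour-surjective (Equivalence.to ∈-vertices⇔ w∈vs) v~w
          in subst (_∈ neighbours) nb≡w (∈-applyUpTo⁺ neighbour t<n)
        from : w ∈ neighbours → w ∈ filterᵇ (adjacent n v) (vertices n)
        from w∈ =
          let t , _ , w≡nb = ∈-applyUpTo⁻ neighbour w∈
          in subst (_∈ filterᵇ (adjacent n v) (vertices n)) (sym w≡nb) (∈-filter⁺ (T? ∘ adjacent n v)
               (Equivalence.from ∈-vertices⇔ (neighbour-isVertex t)) (neighbour-adjacent t))

    degree : length (filterᵇ (adjacent n v) (vertices n)) ≡ n
    degree = trans (unique∧set⇒length≡ (filter⁺ (T? ∘ adjacent n v) vertices-unique) neighbours-unique ∈-neighbours⇔)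
                   (length-applyUpTo neighbour n)

  degree : 2 ≤ n → ∀ {v} → IsVertex v → length (filterᵇ (adjacent n v) (vertices n)) ≡ n
  degree 2≤n {v} (_ , prim , _) = Neighbours.degree 2≤n v (proj₁ partner) (proj₂ partner)
    where
      partner : ∃[ u ] det (ι v) u ≈ + 1
      partner = primitive⇒partner v prim

module AdjacencyMatrix (n : ℕ) .{{_ : NonZero n}} (2≤n : 2 ≤ n) where

  open Congruence n
  open Vertices n

  vtx-isVertex : ∀ i → IsVertex (vtx n i)
  vtx-isVertex i = Equivalence.to ∈-vertices⇔ (∈-lookup i)

  A²-diagonal : ∀ i → A² n i i ≡ + n
  A²-diagonal i = begin
    sumℤ′ (map (λ k → A n i k * A n k i) (allFin (N n)))   ≡⟨ cong sumℤ′ (map-cong closed-walk (allFin (N n))) ⟩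
    sumℤ′ (map (𝟙 ∘ adjacent n v ∘ vtx n) (allFin (N n)))  ≡⟨ cong sumℤ′ (map-lookup-allFin (𝟙 ∘ adjacent n v) (vertices n)) ⟩
    sumℤ′ (map (𝟙 ∘ adjacent n v) (vertices n))            ≡⟨ sum-𝟙≡length-filter (adjacent n v) (vertices n) ⟩
    + length (filterᵇ (adjacent n v) (vertices n))          ≡⟨ cong +_ (degree 2≤n (vtx-isVertex i)) ⟩
    + n                                                     ∎
    where
      open ≡-Reasoning
      v : ℕ × ℕ
      v = vtx n i
      closed-walk : ∀ k → A n i k * A n k i ≡ 𝟙 (adjacent n v (vtx n k))
      closed-walk k = trans (cong (λ b → A n i k * 𝟙 b) (adjacent-sym 2≤n (vtx n k) v)) (𝟙-square _)

  A²-offdiagonal : ∀ i j → i ≢ j → det (ι (vtx n i)) (ι (vtx n j)) ≈ + 0 → A² n i j ≡ + 0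
  A²-offdiagonal i j i≢j det≈0 = sum-zero _ (allFin (N n)) no-walk
    where
      no-walk : ∀ k → A n i k * A n k j ≡ + 0
      no-walk k = 𝟙-*-disjoint {adjacent n (vtx n i) (vtx n k)} {adjacent n (vtx n k) (vtx n j)} λ i~k k~j →
        i≢j (lookup-injective vertices-unique i j
          (common-neighbour⇒≡ 2≤n (vtx n k) (vtx-isVertex i) (vtx-isVertex j) det≈0 i~k k~j))

  A²-nI-diagonal : ∀ i → A²-nI n i i ≡ + 0
  A²-nI-diagonal i = begin
    A² n i i - + n * I n i i  ≡⟨ cong₂ (λ a e → a - + n * e) (A²-diagonal i) (cong 𝟙 (dec-true (i ≟ i) refl)) ⟩
    + n - + n * + 1           ≡⟨ by-ring (+ n) ⟩
    + 0                       ∎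
    where
      open ≡-Reasoning
      by-ring : ∀ m → m - m * + 1 ≡ + 0
      by-ring = solve-∀

  A²-nI-offdiagonal : ∀ i j → i ≢ j → det (ι (vtx n i)) (ι (vtx n j)) ≈ + 0 → A²-nI n i j ≡ + 0
  A²-nI-offdiagonal i j i≢j det≈0 = begin
    A² n i j - + n * I n i j  ≡⟨ cong₂ (λ a e → a - + n * e) (A²-offdiagonal i j i≢j det≈0) (cong 𝟙 (dec-false (i ≟ j) i≢j)) ⟩
    + 0 - + n * + 0           ≡⟨ cong (_-_ (+ 0)) (ℤ.*-zeroʳ (+ n)) ⟩
    + 0                       ∎
    where open ≡-Reasoning

lemma6p2 : (n : ℕ) .{{_ : NonZero n}} → 2 ≤ n →
    (i j : Fin (N n)) →
    detMod n (vtx n i) (vtx n j) ≡ 0 →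
    A²-nI n i j ≡ + 0
lemma6p2 n 2≤n i j detMod≡0 = by-cases (i ≟ j)
  where
    open AdjacencyMatrix n 2≤n
    by-cases : Dec (i ≡ j) → A²-nI n i j ≡ + 0
    by-cases (yes i≡j) = subst (λ k → A²-nI n i k ≡ + 0) i≡j (A²-nI-diagonal i)
    by-cases (no i≢j)  = A²-nI-offdiagonal i j i≢j (Vertices.detMod≡0⇒det≈0 n (vtx n i) (vtx n j) detMod≡0)
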